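{- For every positive integer $k$ there exists a tournament $D$ on $n = 3k$ vertices with no extreme vertices such that $\operatorname{hn}(D) = \frac{2}{3}n$.
   Context: A tournament is an orientation of a complete graph. For an oriented graph $D$: a $(u,v)$-geodesic is a directed $(u,v)$-path with the minimum number of arcs; for $S \subseteq V(D)$ with $|S|\ge 2$, $I(S)$ is the set of vertices lying on some $(u,v)$-geodesic with $u,v \in S$ (endpoints included), and $I(S)=S$ if $|S|\le 1$; $S$ is convex if $I(S)=S$; the hull $[S]$ is the smallest convex set containing $S$; $S$ is a hull set if $[S]=V(D)$; $\operatorname{hn}(D)$ is the minimum size of a hull set. A vertex $v$ is extreme if $d^-(v)=0$, or $d^+(v)=0$, or ($d^-(v)>0$, $d^+(v)>0$ and $(u,w)\in A(D)$ for all in-neighbours $u$ and out-neighbours $w$ of $v$). -}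

module Defs where

open import Data.Nat using (ℕ; zero; suc; _<_)
open import Data.Fin using (Fin; zero; suc; inject₁; fromℕ)
open import Data.Fin.Subset using (Subset; _∈_; _⊆_)
open import Data.Bool using (Bool; true; false)
open import Data.Product using (Σ; ∃; _×_; _,_)
open import Data.Sum using (_⊎_)
open import Relation.Binary.PropositionalEquality using (_≡_; _≢_)
open import Relation.Nullary using (¬_)
open import Function.Definitions using (Injective)

Digraph : ℕ → Set
Digraph n = Fin n → Fin n → Bool

Arc : ∀ {n} → Digraph n → Fin n → Fin n → Set
Arc D u v = D u v ≡ true

IsTournament : ∀ {n} → Digraph n → Set
IsTournament {n} D =
  (∀ (u : Fin n) → D u u ≡ false) ×
  (∀ (u v : Fin n) → u ≢ v →
     (D u v ≡ true × D v u ≡ false) ⊎ (D u v ≡ false × D v u ≡ true))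

record Path {n} (D : Digraph n) (u v : Fin n) (ℓ : ℕ) : Set where
  field
    vert     : Fin (suc ℓ) → Fin n
    distinct : Injective _≡_ _≡_ vert
    arcs     : ∀ (i : Fin ℓ) → Arc D (vert (inject₁ i)) (vert (suc i))
    start    : vert zero ≡ u
    end      : vert (fromℕ ℓ) ≡ v
open Path public

record Geodesic {n} (D : Digraph n) (u v : Fin n) : Set where
  field
    len     : ℕ
    path    : Path D u v len
    minimal : ∀ (m : ℕ) → Path D u v m → ¬ (m < len)
open Geodesic public

OnGeodesic : ∀ {n} {D : Digraph n} {u v : Fin n} → Fin n → Geodesic D u v → Set
OnGeodesic x g = ∃ λ i → vert (path g) i ≡ x

-- x ∈ I(S): x lies on some (u,v)-geodesic with u, v ∈ S.
-- (Pairs with u = v only contribute u itself, so this also gives I(S) = S when |S| ≤ 1.)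
InInterval : ∀ {n} → Digraph n → Subset n → Fin n → Set
InInterval D S x =
  ∃ λ u → ∃ λ v → u ∈ S × v ∈ S × Σ (Geodesic D u v) (λ g → OnGeodesic x g)

-- S is convex if I(S) = S (I(S) ⊇ S always holds).
Convex : ∀ {n} → Digraph n → Subset n → Set
Convex {n} D S = ∀ (x : Fin n) → InInterval D S x → x ∈ S

InHull : ∀ {n} → Digraph n → Subset n → Fin n → Set
InHull D S x = ∀ C → S ⊆ C → Convex D C → x ∈ C

IsHullSet : ∀ {n} → Digraph n → Subset n → Set
IsHullSet D S = ∀ x → InHull D S x

HullNumberIs : ∀ {n} → Digraph n → ℕ → Set
HullNumberIs D h =
  (∃ λ S → IsHullSet D S × Data.Fin.Subset.∣ S ∣ ≡ h) ×
  (∀ S → IsHullSet D S → h Data.Nat.≤ Data.Fin.Subset.∣ S ∣)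

Extreme : ∀ {n} → Digraph n → Fin n → Set
Extreme D v =
  (∀ u → ¬ Arc D u v) ⊎
  (∀ w → ¬ Arc D v w) ⊎
  ((∃ λ u → Arc D u v) × (∃ λ w → Arc D v w) ×
   (∀ u w → Arc D u v → Arc D v w → Arc D u w))

module Submission where

-- The tournament is the lexicographic product T_k[C₃]: k copies ("levels") of
-- the directed triangle C₃, where every vertex of a lower level dominates every
-- vertex of a higher one.  Its vertex set Fin (3 * k) is read as a grid
-- Fin 3 × Fin k of (role, level) pairs via Data.Fin.combine / remQuot.

open import Defs
open import Data.Nat using (ℕ; zero; suc; _≤_; _<_; _+_; _*_; z≤n; s≤s)
open import Data.Nat.Properties
  using (≤-refl; ≤-trans; ≤-antisym; ≤-reflexive; <⇒≤; <⇒≱; +-assoc; +-mono-≤;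
         m≤n⇒m<n∨m≡n; *-comm; +-0-commutativeMonoid)
open import Data.Fin as Fin using (Fin; zero; suc; toℕ; inject₁; fromℕ; _↑ˡ_; _↑ʳ_;
  combine; quotient; remainder)
open import Data.Fin.Properties
  using (<-cmp; toℕ-injective; remQuot-combine; combine-remQuot; combine-injectiveˡ;
         any?; _≟_)
open import Data.Fin.Subset using (Subset; _∈_; _⊆_; ∣_∣; _-_)
open import Data.Fin.Subset.Properties using (_∈?_; x∈p∧x≢y⇒x∈p-y; x∈p⇒∣p-x∣<∣p∣)
open import Data.Vec using (tabulate; lookup)
open import Data.Vec.Properties using (lookup∘tabulate; tabulate∘lookup; []=⇒lookup; lookup⇒[]=)
open import Data.Bool using (Bool; true; false)
open import Data.Bool.Properties using (¬-not)
open import Data.Sum using (_⊎_; inj₁; inj₂)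
open import Data.Product using (∃; ∃₂; _×_; _,_; proj₁; proj₂)
open import Data.Empty using (⊥-elim)
open import Function using (_∘_)
open import Relation.Nullary using (¬_; Dec; does)
open import Relation.Nullary.Decidable
  using (yes; no; _×-dec_; _→-dec_; ¬?; decidable-stable; dec-true)
open import Relation.Binary using (Tri; tri<; tri≈; tri>)
open import Relation.Binary.PropositionalEquality
  using (_≡_; _≢_; refl; sym; trans; cong; cong₂; subst; subst₂; module ≡-Reasoning)
open import Algebra.Properties.CommutativeMonoid.Sum +-0-commutativeMonoid
  using (sum-syntax; sum-cong-≗; ∑-comm)

module _ {n : ℕ} (D : Digraph n) where

  NonTransitiveAt : Fin n → Set
  NonTransitiveAt v = ∃₂ λ u w → Arc D u v × Arc D v w × ¬ Arc D u w

  nonTransitive⇒¬extreme : ∀ {v} → NonTransitiveAt v → ¬ Extreme D v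
  nonTransitive⇒¬extreme (u , w , uv , vw , ¬uw) (inj₁ no-in)                = no-in u uv
  nonTransitive⇒¬extreme (u , w , uv , vw , ¬uw) (inj₂ (inj₁ no-out))        = no-out w vw
  nonTransitive⇒¬extreme (u , w , uv , vw , ¬uw) (inj₂ (inj₂ (_ , _ , tr))) = ¬uw (tr u w uv vw)

  trivialPath : ∀ u → Path D u u 0
  trivialPath u = record
    { vert = λ _ → u ; distinct = λ { {zero} {zero} _ → refl }
    ; arcs = λ () ; start = refl ; end = refl }

  arcPath : ∀ {u v} → u ≢ v → Arc D u v → Path D u v 1
  arcPath {u} {v} u≢v uv = record
    { vert = vert′ ; distinct = injective ; arcs = λ { zero → uv } ; start = refl ; end = refl }
    where
    vert′ : Fin 2 → Fin n
    vert′ zero       = u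
    vert′ (suc zero) = v
    injective : ∀ {a b} → vert′ a ≡ vert′ b → a ≡ b
    injective {zero}     {zero}     _ = refl
    injective {zero}     {suc zero} e = ⊥-elim (u≢v e)
    injective {suc zero} {zero}     e = ⊥-elim (u≢v (sym e))
    injective {suc zero} {suc zero} _ = refl

  twoArcPath : ∀ {u x v} → u ≢ x → x ≢ v → u ≢ v → Arc D u x → Arc D x v → Path D u v 2
  twoArcPath {u} {x} {v} u≢x x≢v u≢v ux xv = record
    { vert = vert′ ; distinct = injective ; arcs = λ { zero → ux ; (suc zero) → xv }
    ; start = refl ; end = refl }
    where
    vert′ : Fin 3 → Fin n
    vert′ zero             = u
    vert′ (suc zero)       = x
    vert′ (suc (suc zero)) = v
    injective : ∀ {a b} → vert′ a ≡ vert′ b → a ≡ b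
    injective {zero}             {zero}             _ = refl
    injective {zero}             {suc zero}         e = ⊥-elim (u≢x e)
    injective {zero}             {suc (suc zero)}   e = ⊥-elim (u≢v e)
    injective {suc zero}         {zero}             e = ⊥-elim (u≢x (sym e))
    injective {suc zero}         {suc zero}         _ = refl
    injective {suc zero}         {suc (suc zero)}   e = ⊥-elim (x≢v e)
    injective {suc (suc zero)}   {zero}             e = ⊥-elim (u≢v (sym e))
    injective {suc (suc zero)}   {suc zero}         e = ⊥-elim (x≢v (sym e))
    injective {suc (suc zero)}   {suc (suc zero)}   _ = refl

  -- A geodesic with at least two arcs joins distinct, non-adjacent vertices
  -- (otherwise the trivial path or the single arc would be shorter).
  longGeodesic : ∀ {u v} (g : Geodesic D u v) → 2 ≤ len g → u ≢ v × ¬ Arc D u v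
  longGeodesic {u} g 2≤len = u≢v , λ uv → minimal g 1 (arcPath u≢v uv) 2≤len
    where
    u≢v : u ≢ _
    u≢v refl = minimal g 0 (trivialPath u) (≤-trans (s≤s z≤n) 2≤len)

  twoArcGeodesic : ∀ {u x v} → u ≢ x → x ≢ v → u ≢ v → Arc D u x → Arc D x v → ¬ Arc D u v →
                   ∃ λ (g : Geodesic D u v) → OnGeodesic x g
  twoArcGeodesic u≢x x≢v u≢v ux xv ¬uv =
    record { len = 2 ; path = twoArcPath u≢x x≢v u≢v ux xv ; minimal = shorter } , suc zero , refl
    where
    shorter : ∀ m → Path D _ _ m → ¬ (m < 2)
    shorter zero           p _ = u≢v (trans (sym (start p)) (end p))
    shorter (suc zero)     p _ = ¬uv (subst₂ (Arc D) (start p) (end p) (arcs p zero))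
    shorter (suc (suc m))  p (s≤s (s≤s ()))

  -- Every convex superset of S contains I(S); so if S ∪ I(S) = V, S is a hull set.
  interval⇒hullSet : ∀ S → (∀ x → x ∈ S ⊎ InInterval D S x) → IsHullSet D S
  interval⇒hullSet S covered x C S⊆C convex with covered x
  ... | inj₁ x∈S = S⊆C x∈S
  ... | inj₂ (u , v , u∈S , v∈S , g) = convex x (u , v , S⊆C u∈S , S⊆C v∈S , g)

-- 2. Graded digraphs

module Graded {n : ℕ} (D : Digraph n) (ℓ : Fin n → ℕ)
               (rises : ∀ {u v} → Arc D u v → ℓ u ≤ ℓ v)
               (jumps : ∀ {u v} → ℓ u < ℓ v → Arc D u v) where

  monotone-from-start : ∀ L (f : Fin (suc L) → ℕ) → (∀ i → f (inject₁ i) ≤ f (suc i)) →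
                        ∀ j → f zero ≤ f j
  monotone-from-start L       f step zero    = ≤-refl
  monotone-from-start (suc L) f step (suc j) =
    ≤-trans (step zero) (monotone-from-start L (f ∘ suc) (step ∘ suc) j)

  monotone-to-end : ∀ L (f : Fin (suc L) → ℕ) → (∀ i → f (inject₁ i) ≤ f (suc i)) →
                    ∀ j → f j ≤ f (fromℕ L)
  monotone-to-end zero    f step zero    = ≤-refl
  monotone-to-end (suc L) f step zero    =
    ≤-trans (step zero) (monotone-to-end L (f ∘ suc) (step ∘ suc) zero)
  monotone-to-end (suc L) f step (suc j) = monotone-to-end L (f ∘ suc) (step ∘ suc) j

  path-between : ∀ {u v L} (p : Path D u v L) j → ℓ u ≤ ℓ (vert p j) × ℓ (vert p j) ≤ ℓ v
  path-between {u} {v} {L} p j =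
      subst (λ a → ℓ a ≤ ℓ (vert p j)) (start p) (monotone-from-start L level step j)
    , subst (λ b → ℓ (vert p j) ≤ ℓ b) (end p) (monotone-to-end L level step j)
    where
    level : Fin (suc L) → ℕ
    level = ℓ ∘ vert p
    step : ∀ i → level (inject₁ i) ≤ level (suc i)
    step i = rises (arcs p i)

  -- A vertex on a (u,v)-geodesic is u, v, or else u ≠ v and all three share a level:
  -- for a geodesic with ≥ 2 arcs, u and v are non-adjacent, hence on the same level.
  geodesic-interior : ∀ {u v x} (g : Geodesic D u v) → OnGeodesic x g →
                      x ≡ u ⊎ x ≡ v ⊎ (u ≢ v × ℓ x ≡ ℓ u × ℓ x ≡ ℓ v)
  geodesic-interior record { len = zero          ; path = p } (zero , e)     =
    inj₁ (trans (sym e) (start p))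
  geodesic-interior record { len = suc zero      ; path = p } (zero , e)     =
    inj₁ (trans (sym e) (start p))
  geodesic-interior record { len = suc zero      ; path = p } (suc zero , e) =
    inj₂ (inj₁ (trans (sym e) (end p)))
  geodesic-interior {u} {v} g@record { len = suc (suc L) ; path = p } (j , refl) =
    inj₂ (inj₂ (u≢v , ≤-antisym x≤u u≤x , ≤-antisym x≤v v≤x))
    where
    u≢v : u ≢ v
    u≢v = proj₁ (longGeodesic D g (s≤s (s≤s z≤n)))
    ¬uv : ¬ Arc D u v
    ¬uv = proj₂ (longGeodesic D g (s≤s (s≤s z≤n)))
    u≤x : ℓ u ≤ ℓ (vert p j)
    u≤x = proj₁ (path-between p j)
    x≤v : ℓ (vert p j) ≤ ℓ v
    x≤v = proj₂ (path-between p j)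
    same : ℓ u ≡ ℓ v
    same with m≤n⇒m<n∨m≡n (≤-trans u≤x x≤v)
    ... | inj₁ u<v = ⊥-elim (¬uv (jumps u<v))
    ... | inj₂ u≡v = u≡v
    x≤u : ℓ (vert p j) ≤ ℓ u
    x≤u = subst (ℓ (vert p j) ≤_) (sym same) x≤v
    v≤x : ℓ v ≤ ℓ (vert p j)
    v≤x = subst (_≤ ℓ (vert p j)) same u≤x

  convex-by-levels : ∀ C → (∀ {u v x} → u ∈ C → v ∈ C → u ≢ v → ℓ u ≡ ℓ v → ℓ x ≡ ℓ u → x ∈ C) →
                     Convex D C
  convex-by-levels C closed x (u , v , u∈C , v∈C , g , on) with geodesic-interior g on
  ... | inj₁ refl                      = u∈C
  ... | inj₂ (inj₁ refl)               = v∈C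
  ... | inj₂ (inj₂ (u≢v , xu , xv))    = closed u∈C v∈C u≢v (trans (sym xu) xv) xu

weight : Bool → ℕ
weight true  = 1
weight false = 0

count-tabulate : ∀ {n} (f : Fin n → Bool) → ∣ tabulate f ∣ ≡ ∑[ v < n ] weight (f v)
count-tabulate {zero}  f = refl
count-tabulate {suc n} f with f zero
... | true  = cong suc (count-tabulate (f ∘ suc))
... | false = count-tabulate (f ∘ suc)

count-as-sum : ∀ {n} (S : Subset n) → ∣ S ∣ ≡ ∑[ v < n ] weight (lookup S v)
count-as-sum S = trans (cong ∣_∣ (sym (tabulate∘lookup S))) (count-tabulate (lookup S))

∑-split : ∀ k n (f : Fin (k + n) → ℕ) →
          ∑[ v < k + n ] f v ≡ ∑[ i < k ] f (i ↑ˡ n) + ∑[ j < n ] f (k ↑ʳ j)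
∑-split zero    n f = refl
∑-split (suc k) n f =
  trans (cong (f zero +_) (∑-split k n (f ∘ suc)))
        (sym (+-assoc (f zero) (∑[ i < k ] f (suc (i ↑ˡ n))) (∑[ j < n ] f (suc k ↑ʳ j))))

∑-combine : ∀ m k (f : Fin (m * k) → ℕ) →
            ∑[ v < m * k ] f v ≡ ∑[ r < m ] ∑[ i < k ] f (combine r i)
∑-combine zero    k f = refl
∑-combine (suc m) k f =
  trans (∑-split k (m * k) f)
        (cong (∑[ i < k ] f (combine {suc m} zero i) +_) (∑-combine m k (f ∘ (k ↑ʳ_))))

∑-lower-bound : ∀ {k} c (f : Fin k → ℕ) → (∀ i → c ≤ f i) → k * c ≤ ∑[ i < k ] f i
∑-lower-bound {zero}  c f c≤f = z≤n
∑-lower-bound {suc k} c f c≤f = +-mono-≤ (c≤f zero) (∑-lower-bound c (f ∘ suc) (c≤f ∘ suc))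

∑-constant : ∀ {k} c (f : Fin k → ℕ) → (∀ i → f i ≡ c) → ∑[ i < k ] f i ≡ k * c
∑-constant {zero}  c f f≡c = refl
∑-constant {suc k} c f f≡c = cong₂ _+_ (f≡c zero) (∑-constant c (f ∘ suc) (f≡c ∘ suc))

subsetOf : ∀ {n} {P : Fin n → Set} → (∀ v → Dec (P v)) → Subset n
subsetOf P? = tabulate (does ∘ P?)

∈-subsetOf⁺ : ∀ {n} {P : Fin n → Set} (P? : ∀ v → Dec (P v)) {v} → P v → v ∈ subsetOf P?
∈-subsetOf⁺ P? {v} pv =
  lookup⇒[]= v (subsetOf P?) (trans (lookup∘tabulate (does ∘ P?) v) (dec-true (P? v) pv))

∈-subsetOf⁻ : ∀ {n} {P : Fin n → Set} (P? : ∀ v → Dec (P v)) {v} → v ∈ subsetOf P? → P v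
∈-subsetOf⁻ P? {v} v∈ = holds (P? v) (trans (sym (lookup∘tabulate (does ∘ P?) v)) ([]=⇒lookup v∈))
  where
  holds : ∀ {A : Set} (a? : Dec A) → does a? ≡ true → A
  holds (yes a) _ = a

outside-singleton : ∀ {n} (p : Subset n) s → ¬ (∀ r → r ∈ p → r ≡ s) → ∃ λ r → r ∈ p × r ≢ s
outside-singleton p s not-within with any? (λ r → r ∈? p ×-dec ¬? (r ≟ s))
... | yes witness = witness
... | no none     = ⊥-elim (not-within λ r r∈p →
                      decidable-stable (r ≟ s) (λ r≢s → none (r , r∈p , r≢s)))

two-elements : ∀ {m} (p : Subset m) (s₀ : Fin m) → (∀ s → ¬ (∀ r → r ∈ p → r ≡ s)) → 2 ≤ ∣ p ∣
two-elements p s₀ spread with outside-singleton p s₀ (spread s₀)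
... | x , x∈p , _ with outside-singleton p x (spread x)
... | y , y∈p , y≢x = ≤-trans (s≤s 1≤∣p-x∣) (x∈p⇒∣p-x∣<∣p∣ x∈p)
  where
  1≤∣p-x∣ : 1 ≤ ∣ p - x ∣
  1≤∣p-x∣ = ≤-trans (s≤s z≤n) (x∈p⇒∣p-x∣<∣p∣ (x∈p∧x≢y⇒x∈p-y y∈p y≢x))

-- 4. The lexicographic product T_k[H]

module Grid (m k : ℕ) where

  cell : Fin m → Fin k → Fin (m * k)
  cell = combine

  role : Fin (m * k) → Fin m
  role = quotient k

  level : Fin (m * k) → Fin k
  level = remainder {m} k

  role-cell : ∀ (r : Fin m) (i : Fin k) → role (cell r i) ≡ r
  role-cell r i = cong proj₁ (remQuot-combine r i)

  level-cell : ∀ (r : Fin m) (i : Fin k) → level (cell r i) ≡ i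
  level-cell r i = cong proj₂ (remQuot-combine r i)

  cell-role-level : ∀ v → cell (role v) (level v) ≡ v
  cell-role-level = combine-remQuot {m} k

  grid-ext : ∀ {u v} → role u ≡ role v → level u ≡ level v → u ≡ v
  grid-ext {u} {v} same-role same-level =
    trans (sym (cell-role-level u))
          (trans (cong₂ cell same-role same-level) (cell-role-level v))

  entry : Subset (m * k) → Fin m → Fin k → Bool
  entry S r i = lookup S (cell r i)

  column : Subset (m * k) → Fin k → Subset m
  column S i = tabulate (λ r → entry S r i)

  ∈-column⁺ : ∀ {S i r} → cell r i ∈ S → r ∈ column S i
  ∈-column⁺ {S} {i} {r} ∈S =
    lookup⇒[]= r (column S i) (trans (lookup∘tabulate (λ r → entry S r i) r) ([]=⇒lookup ∈S))

  count-by-columns : ∀ S → ∣ S ∣ ≡ ∑[ i < k ] ∣ column S i ∣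
  count-by-columns S = begin
    ∣ S ∣
      ≡⟨ count-as-sum S ⟩
    ∑[ v < m * k ] weight (lookup S v)
      ≡⟨ ∑-combine m k (weight ∘ lookup S) ⟩
    ∑[ r < m ] ∑[ i < k ] weight (entry S r i)
      ≡⟨ ∑-comm {m} {k} (λ r i → weight (entry S r i)) ⟩
    ∑[ i < k ] ∑[ r < m ] weight (entry S r i)
      ≡⟨ sum-cong-≗ {k} (λ i → sym (count-tabulate (λ r → entry S r i))) ⟩
    ∑[ i < k ] ∣ column S i ∣
      ∎
    where open ≡-Reasoning

Comparison : ∀ {k} → Fin k → Fin k → Set
Comparison i j = Tri (i Fin.< j) (i ≡ j) (j Fin.< i)

byLevel : ∀ {k} {i j : Fin k} → Comparison i j → Bool → Bool
byLevel (tri< _ _ _) _ = true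
byLevel (tri≈ _ _ _) b = b
byLevel (tri> _ _ _) _ = false

byLevel-up : ∀ {k} {i j : Fin k} (c : Comparison i j) {b} → i Fin.< j → byLevel c b ≡ true
byLevel-up (tri< _  _ _) _  = refl
byLevel-up (tri≈ ≮ _ _) lt = ⊥-elim (≮ lt)
byLevel-up (tri> ≮ _ _) lt = ⊥-elim (≮ lt)

byLevel-same : ∀ {k} {i j : Fin k} (c : Comparison i j) {b} → i ≡ j → byLevel c b ≡ b
byLevel-same (tri< _ ≢ _) eq = ⊥-elim (≢ eq)
byLevel-same (tri≈ _ _ _) _  = refl
byLevel-same (tri> _ ≢ _) eq = ⊥-elim (≢ eq)

byLevel-rises : ∀ {k} {i j : Fin k} (c : Comparison i j) {b} → byLevel c b ≡ true → i Fin.≤ j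
byLevel-rises (tri< lt _ _) _ = <⇒≤ lt
byLevel-rises (tri≈ _ eq _) _ = ≤-reflexive (cong toℕ eq)

module Lexicographic {m : ℕ} (H : Digraph m) (k : ℕ) where
  open Grid m k public

  Lex : Digraph (m * k)
  Lex u v = byLevel (<-cmp (level u) (level v)) (H (role u) (role v))

  Lex-up : ∀ {u v} → level u Fin.< level v → Arc Lex u v
  Lex-up {u} {v} = byLevel-up (<-cmp (level u) (level v))

  Lex-rises : ∀ {u v} → Arc Lex u v → level u Fin.≤ level v
  Lex-rises {u} {v} = byLevel-rises (<-cmp (level u) (level v))

  Lex-down : ∀ {u v} → level u Fin.< level v → Lex v u ≡ false
  Lex-down lt = ¬-not (λ vu → <⇒≱ lt (Lex-rises vu))

  Lex-same : ∀ {u v r s} → level u ≡ level v → role u ≡ r → role v ≡ s → Lex u v ≡ H r s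
  Lex-same {u} {v} same-level refl refl = byLevel-same (<-cmp (level u) (level v)) same-level

  Lex-within-level : ∀ r s i → Lex (cell r i) (cell s i) ≡ H r s
  Lex-within-level r s i =
    Lex-same (trans (level-cell r i) (sym (level-cell s i))) (role-cell r i) (role-cell s i)

  Lex-tournament : IsTournament H → IsTournament Lex
  Lex-tournament (irreflexive , total) = irreflexive′ , total′
    where
    irreflexive′ : ∀ u → Lex u u ≡ false
    irreflexive′ u = trans (Lex-same refl refl refl) (irreflexive (role u))
    total′ : ∀ u v → u ≢ v → (Lex u v ≡ true × Lex v u ≡ false) ⊎ (Lex u v ≡ false × Lex v u ≡ true)
    total′ u v u≢v = by-comparison (<-cmp (level u) (level v))
      where
      by-comparison : Comparison (level u) (level v) →
                      (Lex u v ≡ true × Lex v u ≡ false) ⊎ (Lex u v ≡ false × Lex v u ≡ true)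
      by-comparison (tri< lt _ _) = inj₁ (Lex-up lt , Lex-down lt)
      by-comparison (tri> _ _ gt) = inj₂ (Lex-down gt , Lex-up gt)
      by-comparison (tri≈ _ eq _) rewrite Lex-same eq refl refl | Lex-same (sym eq) refl refl =
        total (role u) (role v) (λ same-role → u≢v (grid-ext same-role eq))

  Lex-nonTransitive : ∀ v → NonTransitiveAt H (role v) → NonTransitiveAt Lex v
  Lex-nonTransitive v (p , w , pv , vw , ¬pw) =
      cell p i , cell w i
    , trans (Lex-same (level-cell p i) (role-cell p i) refl) pv
    , trans (Lex-same (sym (level-cell w i)) refl (role-cell w i)) vw
    , λ pw → ¬pw (trans (sym (Lex-same (trans (level-cell p i) (sym (level-cell w i)))
                                        (role-cell p i) (role-cell w i))) pw)
    where
    i : Fin k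
    i = level v

  open Graded Lex (toℕ ∘ level) Lex-rises Lex-up using (convex-by-levels)

  Kept : Fin k → Fin m → Fin (m * k) → Set
  Kept i s v = level v ≡ i → role v ≡ s

  kept? : ∀ i s v → Dec (Kept i s v)
  kept? i s v = (level v ≟ i) →-dec (role v ≟ s)

  kept : Fin k → Fin m → Subset (m * k)
  kept i s = subsetOf (kept? i s)

  -- This set is convex: two distinct kept vertices on a common level cannot
  -- both lie on level i, so that level is entirely kept.
  kept-convex : ∀ i s → Convex Lex (kept i s)
  kept-convex i s = convex-by-levels (kept i s) closed
    where
    closed : ∀ {u v x} → u ∈ kept i s → v ∈ kept i s → u ≢ v →
             toℕ (level u) ≡ toℕ (level v) → toℕ (level x) ≡ toℕ (level u) → x ∈ kept i s
    closed {u} {v} {x} u∈ v∈ u≢v same-uv same-xu = ∈-subsetOf⁺ (kept? i s) λ x-on-i →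
      ⊥-elim (u≢v (grid-ext (same-role x-on-i) (toℕ-injective same-uv)))
      where
      u-on-i : level x ≡ i → level u ≡ i
      u-on-i x-on-i = trans (toℕ-injective (sym same-xu)) x-on-i
      v-on-i : level x ≡ i → level v ≡ i
      v-on-i x-on-i = trans (toℕ-injective (sym same-uv)) (u-on-i x-on-i)
      same-role : level x ≡ i → role u ≡ role v
      same-role x-on-i = trans (∈-subsetOf⁻ (kept? i s) u∈ (u-on-i x-on-i))
                               (sym (∈-subsetOf⁻ (kept? i s) v∈ (v-on-i x-on-i)))

  -- If column i of a hull set lies within {s}, then s is the only role of H:
  -- kept i s is a convex superset of S, so it contains cell t i for every t.
  hull-column-spread : ∀ S → IsHullSet Lex S → ∀ i s → (∀ r → r ∈ column S i → r ≡ s) → ∀ t → t ≡ s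
  hull-column-spread S hull i s within t =
    trans (sym (role-cell t i)) (∈-subsetOf⁻ (kept? i s) cell∈kept (level-cell t i))
    where
    S⊆kept : S ⊆ kept i s
    S⊆kept {v} v∈S = ∈-subsetOf⁺ (kept? i s) {v} λ v-on-i →
      within (role v) (∈-column⁺ (subst (_∈ S) (sym (on-level-i v-on-i)) v∈S))
      where
      on-level-i : level v ≡ i → cell (role v) i ≡ v
      on-level-i v-on-i = trans (cong (cell (role v)) (sym v-on-i)) (cell-role-level v)
    cell∈kept : cell t i ∈ kept i s
    cell∈kept = hull (cell t i) (kept i s) S⊆kept (kept-convex i s)

  hull-lower-bound : ∀ {a b : Fin m} → a ≢ b → ∀ S → IsHullSet Lex S → k * 2 ≤ ∣ S ∣
  hull-lower-bound {a} {b} a≢b S hull =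
    subst (k * 2 ≤_) (sym (count-by-columns S)) (∑-lower-bound 2 _ column-size)
    where
    column-size : ∀ i → 2 ≤ ∣ column S i ∣
    column-size i = two-elements (column S i) a λ s within →
      let only-s = hull-column-spread S hull i s within in a≢b (trans (only-s a) (sym (only-s b)))

-- 5. The directed triangle and the theorem

C₃ : Digraph 3
C₃ zero             (suc zero)       = true
C₃ (suc zero)       (suc (suc zero)) = true
C₃ (suc (suc zero)) zero             = true
C₃ _                _                = false

one apex : Fin 3
one  = suc zero
apex = suc (suc zero)

C₃-tournament : IsTournament C₃
C₃-tournament = irreflexive , total
  where
  irreflexive : ∀ r → C₃ r r ≡ false
  irreflexive zero             = refl
  irreflexive (suc zero)       = refl
  irreflexive (suc (suc zero)) = refl
  total : ∀ r s → r ≢ s → (C₃ r s ≡ true × C₃ s r ≡ false) ⊎ (C₃ r s ≡ false × C₃ s r ≡ true)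
  total zero             zero             r≢s = ⊥-elim (r≢s refl)
  total zero             (suc zero)       _   = inj₁ (refl , refl)
  total zero             (suc (suc zero)) _   = inj₂ (refl , refl)
  total (suc zero)       zero             _   = inj₂ (refl , refl)
  total (suc zero)       (suc zero)       r≢s = ⊥-elim (r≢s refl)
  total (suc zero)       (suc (suc zero)) _   = inj₁ (refl , refl)
  total (suc (suc zero)) zero             _   = inj₁ (refl , refl)
  total (suc (suc zero)) (suc zero)       _   = inj₂ (refl , refl)
  total (suc (suc zero)) (suc (suc zero)) r≢s = ⊥-elim (r≢s refl)

C₃-nonTransitive : ∀ r → NonTransitiveAt C₃ r
C₃-nonTransitive zero             = suc (suc zero) , suc zero       , refl , refl , λ ()
C₃-nonTransitive (suc zero)       = zero           , suc (suc zero) , refl , refl , λ ()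
C₃-nonTransitive (suc (suc zero)) = suc zero       , zero           , refl , refl , λ ()

module Triangles (k : ℕ) where
  open Lexicographic C₃ k public

  base? : ∀ v → Dec (role v ≢ apex)
  base? v = ¬? (role v ≟ apex)

  baseSet : Subset (3 * k)
  baseSet = subsetOf base?

  cell-≢ : ∀ r s i → r ≢ s → cell r i ≢ cell s i
  cell-≢ r s i r≢s e = r≢s (combine-injectiveˡ r i s i e)

  base-∈ : ∀ r i → r ≢ apex → cell r i ∈ baseSet
  base-∈ r i r≢apex = ∈-subsetOf⁺ base? (subst (_≢ apex) (sym (role-cell r i)) r≢apex)

  -- The apex of level i lies on the geodesic 1 → apex → 0 of that level.
  apex-in-interval : ∀ i → InInterval Lex baseSet (cell apex i)
  apex-in-interval i =
    cell one i , cell zero i , base-∈ one i (λ ()) , base-∈ zero i (λ ()) ,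
    twoArcGeodesic Lex
      (cell-≢ one apex i (λ ())) (cell-≢ apex zero i (λ ())) (cell-≢ one zero i (λ ()))
      (Lex-within-level one apex i) (Lex-within-level apex zero i)
      (λ arc → false≢true (trans (sym (Lex-within-level one zero i)) arc))
    where
    false≢true : false ≢ true
    false≢true ()

  baseSet-hull : IsHullSet Lex baseSet
  baseSet-hull = interval⇒hullSet Lex baseSet λ v →
    subst (λ x → x ∈ baseSet ⊎ InInterval Lex baseSet x) (cell-role-level v)
          (on-grid (role v) (level v))
    where
    on-grid : ∀ r i → cell r i ∈ baseSet ⊎ InInterval Lex baseSet (cell r i)
    on-grid zero             i = inj₁ (base-∈ zero i (λ ()))
    on-grid (suc zero)       i = inj₁ (base-∈ one i (λ ()))
    on-grid (suc (suc zero)) i = inj₂ (apex-in-interval i)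

  baseSet-size : ∣ baseSet ∣ ≡ 2 * k
  baseSet-size = begin
    ∣ baseSet ∣                     ≡⟨ count-by-columns baseSet ⟩
    ∑[ i < k ] ∣ column baseSet i ∣ ≡⟨ ∑-constant 2 _ column-size ⟩
    k * 2                           ≡⟨ *-comm k 2 ⟩
    2 * k                           ∎
    where
    open ≡-Reasoning
    column-size : ∀ i → ∣ column baseSet i ∣ ≡ 2
    column-size i = trans (count-tabulate (λ r → entry baseSet r i)) (sum-cong-≗ {3} λ r →
      cong weight (trans (lookup∘tabulate (does ∘ base?) (cell r i))
                         (cong (λ x → does (¬? (x ≟ apex))) (role-cell r i))))

-- T_k[C₃] is a tournament without extreme vertices and with hull number 2k.
proposition2 : ∀ (k : ℕ) → 1 ≤ k →
    ∃ λ (D : Digraph (3 * k)) →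
      IsTournament D × (∀ v → ¬ Extreme D v) × HullNumberIs D (2 * k)
proposition2 k _ =
    Lex
  , Lex-tournament C₃-tournament
  , (λ v → nonTransitive⇒¬extreme Lex (Lex-nonTransitive v (C₃-nonTransitive (role v))))
  , (baseSet , baseSet-hull , baseSet-size)
  , λ S hull → subst (_≤ ∣ S ∣) (*-comm k 2) (hull-lower-bound {zero} {one} (λ ()) S hull)
  where
  open Triangles k
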